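{- Let $\beta=(\beta_1,\dots,\beta_m)$ be a weak composition of $n$ and $w=w_1\cdots w_n\in W_\beta$ with $w_n\ne1$. Then $\mathrm{maj}(c.w)=\mathrm{maj}(w)+\beta_1$.
   Context: $W_\beta$ is the set of words with exactly $\beta_j$ copies of letter $j$ for $1\le j\le m$. $\mathrm{maj}(w)=\sum_{p:w_p>w_{p+1}}p$. The operator $c$ decrements every letter by $1$ modulo $m$: $c.w=c(w_1)\cdots c(w_n)$ with $c(j)=j-1$ for $1<j\le m$ and $c(1)=m$. -}

module Defs where

open import Data.Nat using (ℕ; zero; suc; _+_)
open import Data.Fin using (Fin; zero; suc; fromℕ; inject₁; _<?_)
open import Data.Vec using (Vec; []; _∷_; count; sum; lookup; map)
open import Relation.Nullary using (does)
open import Data.Bool using (true; false; if_then_else_)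
open import Relation.Binary.PropositionalEquality using (_≡_)
open import Data.Fin using (_≟_)

-- Letters 1..m are represented by Fin m: letter j is the element with toℕ = j - 1.
-- The letter "1" is therefore zero : Fin (suc m).

IsWeakComposition : {m : ℕ} → Vec ℕ m → ℕ → Set
IsWeakComposition β n = sum β ≡ n

occ : {m n : ℕ} → Fin m → Vec (Fin m) n → ℕ
occ a w = count (λ x → x ≟ a) w

InW : {m n : ℕ} → Vec ℕ m → Vec (Fin m) n → Set
InW {m} β w = (j : Fin m) → occ j w ≡ lookup β j

-- maj with 1-indexed positions.
-- majAux p x w : contribution of descents of the word x w, where x sits at position p
descentAt : {m : ℕ} → ℕ → Fin m → Fin m → ℕ
descentAt p x y = if does (y <? x) then p else 0

majAux : {m n : ℕ} → ℕ → Fin m → Vec (Fin m) n → ℕ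
majAux p x [] = 0
majAux p x (y ∷ w) = descentAt p x y + majAux (suc p) y w

majFrom : {m n : ℕ} → ℕ → Vec (Fin m) n → ℕ
majFrom p [] = 0
majFrom p (x ∷ w) = majAux p x w

maj : {m n : ℕ} → Vec (Fin m) n → ℕ
maj = majFrom 1

-- c(j) = j - 1 for 1 < j ≤ m, c(1) = m
cLetter : {m : ℕ} → Fin m → Fin m
cLetter {suc m} zero = fromℕ m
cLetter {suc m} (suc j) = inject₁ j

cAct : {m n : ℕ} → Vec (Fin m) n → Vec (Fin m) n
cAct = map cLetter

-- The operator c changes the descent set only at factors involving the letter 1: a factor 1y
-- (y ≠ 1) at position p becomes a descent and a factor x1 (x ≠ 1) stops being one.  Giving every
-- letter 1 at position q the weight q, the change in maj is therefore the sum of the weights at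
-- positions p minus those at positions p + 1; this telescopes, and as the last letter is not 1,
-- what is left is one unit per letter 1, i.e. β₁.
module Submission where

open import Defs
open import Data.Nat using (ℕ; suc; _+_)
open import Data.Fin using (Fin; zero)
open import Data.Vec using (Vec; last; lookup)
open import Relation.Binary.PropositionalEquality using (_≡_; _≢_)

open import Data.Nat using (_*_)
open import Data.Nat.Properties using (*-suc; *-identityʳ; +-identityʳ)
open import Data.Nat.Solver using (module +-*-Solver)
open import Data.Fin using (suc; toℕ; fromℕ; inject₁; _<_; _<?_)
open import Data.Fin.Properties using (toℕ-fromℕ; toℕ-inject₁; inject₁ℕ<; <-irrefl; <-asym)
open import Data.Vec using ([]; _∷_)
open import Data.Empty using (⊥-elim)
open import Relation.Nullary using (¬_)
open import Relation.Nullary.Decidable using (dec-true; dec-false)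
open import Relation.Binary.PropositionalEquality using (refl; cong; sym; subst; module ≡-Reasoning)

χ₁ : {m : ℕ} → Fin (suc m) → ℕ
χ₁ zero    = 1
χ₁ (suc _) = 0

occ-zero-∷ : {m n : ℕ} (x : Fin (suc m)) (w : Vec (Fin (suc m)) n) →
             occ zero (x ∷ w) ≡ χ₁ x + occ zero w
occ-zero-∷ zero    w = refl
occ-zero-∷ (suc _) w = refl

inject₁<fromℕ : {m : ℕ} (i : Fin m) → inject₁ i < fromℕ m
inject₁<fromℕ {m} i = subst (toℕ (inject₁ i) Data.Nat.<_) (sym (toℕ-fromℕ m)) (inject₁ℕ< i)

descentAt-< : {m : ℕ} (p : ℕ) {x y : Fin m} → y < x → descentAt p x y ≡ p
descentAt-< p {x} {y} y<x rewrite dec-true (y <? x) y<x = refl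

descentAt-≮ : {m : ℕ} (p : ℕ) {x y : Fin m} → ¬ y < x → descentAt p x y ≡ 0
descentAt-≮ p {x} {y} y≮x rewrite dec-false (y <? x) y≮x = refl

descentAt-inject₁ : {m : ℕ} (p : ℕ) (i j : Fin m) →
                    descentAt p (inject₁ i) (inject₁ j) ≡ descentAt p (suc i) (suc j)
descentAt-inject₁ p i j rewrite toℕ-inject₁ i | toℕ-inject₁ j = refl

descentAt-cLetter : {m : ℕ} (p : ℕ) (x y : Fin (suc m)) →
                    descentAt p (cLetter x) (cLetter y) + χ₁ y * p ≡ descentAt p x y + χ₁ x * p
descentAt-cLetter {m} p zero zero = cong (_+ 1 * p) (descentAt-≮ p {fromℕ m} (<-irrefl refl))
descentAt-cLetter p zero (suc j) = cong (_+ 0 * p) (descentAt-< p (inject₁<fromℕ j))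
descentAt-cLetter p (suc i) zero = cong (_+ 1 * p) (descentAt-≮ p (<-asym (inject₁<fromℕ i)))
descentAt-cLetter p (suc i) (suc j) = cong (_+ 0 * p) (descentAt-inject₁ p i j)

majAux-cAct : {m n : ℕ} (p : ℕ) (x : Fin (suc m)) (w : Vec (Fin (suc m)) n) →
              last (x ∷ w) ≢ zero →
              majAux p (cLetter x) (cAct w) ≡ majAux p x w + occ zero w + χ₁ x * p
majAux-cAct p zero    []      x≢1 = ⊥-elim (x≢1 refl)
majAux-cAct p (suc _) []      x≢1 = refl
majAux-cAct p x       (y ∷ w) w≢1 = begin
  d′ + majAux (suc p) (cLetter y) (cAct w)  ≡⟨ cong (d′ +_) (majAux-cAct (suc p) y w w≢1) ⟩
  d′ + (A + o + χ₁ y * suc p)               ≡⟨ cong (λ k → d′ + (A + o + k)) (*-suc (χ₁ y) p) ⟩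
  d′ + (A + o + (χ₁ y + χ₁ y * p))          ≡⟨ rearrange d′ A o (χ₁ y) (χ₁ y * p) ⟩
  (d′ + χ₁ y * p) + A + (χ₁ y + o)          ≡⟨ cong (λ k → k + A + (χ₁ y + o)) (descentAt-cLetter p x y) ⟩
  (d + χ₁ x * p) + A + (χ₁ y + o)           ≡⟨ rearrange′ d (χ₁ x * p) A (χ₁ y + o) ⟩
  d + A + (χ₁ y + o) + χ₁ x * p             ≡⟨ cong (λ k → d + A + k + χ₁ x * p) (sym (occ-zero-∷ y w)) ⟩
  d + A + occ zero (y ∷ w) + χ₁ x * p       ∎
  where
  open ≡-Reasoning
  open +-*-Solver
  d′ = descentAt p (cLetter x) (cLetter y)
  d  = descentAt p x y
  A  = majAux (suc p) y w
  o  = occ zero w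
  rearrange : ∀ a b c e f → a + (b + c + (e + f)) ≡ (a + f) + b + (e + c)
  rearrange = solve 5 (λ a b c e f → a :+ (b :+ c :+ (e :+ f)) := (a :+ f) :+ b :+ (e :+ c)) refl
  rearrange′ : ∀ a b c e → (a + b) + c + e ≡ a + c + e + b
  rearrange′ = solve 4 (λ a b c e → (a :+ b) :+ c :+ e := a :+ c :+ e :+ b) refl

lemma3p3 : (m n : ℕ) (β : Vec ℕ (suc m)) (w : Vec (Fin (suc m)) (suc n))
    → IsWeakComposition β (suc n) → InW β w → last w ≢ zero
    → maj (cAct w) ≡ maj w + lookup β zero
lemma3p3 m n β (x ∷ w) _ inW w≢1 = begin
  majAux 1 (cLetter x) (cAct w)        ≡⟨ majAux-cAct 1 x w w≢1 ⟩
  majAux 1 x w + occ zero w + χ₁ x * 1 ≡⟨ cong (majAux 1 x w + occ zero w +_) (*-identityʳ (χ₁ x)) ⟩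
  majAux 1 x w + occ zero w + χ₁ x      ≡⟨ rearrange (majAux 1 x w) (occ zero w) (χ₁ x) ⟩
  majAux 1 x w + (χ₁ x + occ zero w)    ≡⟨ cong (majAux 1 x w +_) (sym (occ-zero-∷ x w)) ⟩
  majAux 1 x w + occ zero (x ∷ w)       ≡⟨ cong (majAux 1 x w +_) (inW zero) ⟩
  majAux 1 x w + lookup β zero          ∎
  where
  open ≡-Reasoning
  open +-*-Solver
  rearrange : ∀ a b c → a + b + c ≡ a + (c + b)
  rearrange = solve 3 (λ a b c → a :+ b :+ c := a :+ (c :+ b)) refl
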